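{- Let $G$ be a cograph. Then \[\alpha'(G)=\max\Big\{\sum_{x\in W} d'(x)\;\Big|\; W \text{ is an independent set in } G\Big\}.\]
   Context: A cograph is a finite simple graph with no induced path on four vertices. A set $A$ of edges of $G$ is independent if no two edges of $A$ are contained in a common clique (complete subgraph) of $G$; $\alpha'(G)$ is the maximum cardinality of an independent set of edges of $G$ (equivalently the independence number of the edge-clique graph $K_e(G)$, whose vertices are the edges of $G$, adjacent when contained in a common clique). An independent set of vertices is a nonempty set of pairwise nonadjacent vertices. For a vertex $x$, $N(x)$ is its (open) neighborhood and $d'(x)=\alpha(G[N(x)])$ is the independence number of the subgraph induced by $N(x)$. -}

module Defs where

open import Data.Nat using (ℕ; _≤_; _<_)
open import Data.Fin using (Fin) renaming (_<_ to _<ᶠ_)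
open import Data.Bool using (Bool; T)
open import Data.List using (List; []; _∷_; length; map)
open import Data.Nat.ListAction using (sum)
open import Data.List.Membership.Propositional using (_∈_)
open import Data.List.Relation.Unary.All using (All)
open import Data.List.Relation.Unary.AllPairs using (AllPairs)
open import Data.Product using (_×_; ∃; Σ; _,_; proj₁)
open import Data.Empty using (⊥)
open import Relation.Nullary using (¬_)
open import Relation.Binary.PropositionalEquality using (_≡_; _≢_)

record Graph (n : ℕ) : Set where
  field
    adj    : Fin n → Fin n → Bool
    sym    : ∀ x y → adj x y ≡ adj y x
    irrefl : ∀ x → ¬ T (adj x x)

module _ {n : ℕ} (G : Graph n) where
  open Graph G

  Adj : Fin n → Fin n → Set
  Adj x y = T (adj x y)

  Cograph : Set
  Cograph = ∀ a b c d →
    a ≢ b → a ≢ c → a ≢ d → b ≢ c → b ≢ d → c ≢ d →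
    Adj a b → Adj b c → Adj c d →
    ¬ Adj a c → ¬ Adj b d → ¬ Adj a d → ⊥

  Clique : List (Fin n) → Set
  Clique S = AllPairs (λ x y → x ≢ y × Adj x y) S

  -- an edge {u,v}, represented canonically as an ordered pair with u < v
  Edge : Set
  Edge = Σ (Fin n) λ u → Σ (Fin n) λ v → u <ᶠ v × Adj u v

  e₁ e₂ : Edge → Fin n
  e₁ (u , _) = u
  e₂ (_ , v , _) = v

  CommonClique : Edge → Edge → Set
  CommonClique e f = ∃ λ S → Clique S × e₁ e ∈ S × e₂ e ∈ S × e₁ f ∈ S × e₂ f ∈ S

  -- an independent set of edges (listed without repetition, which is forced
  -- since an edge lies in a common clique with itself)
  IndepEdges : List Edge → Set
  IndepEdges A = AllPairs (λ e f → ¬ CommonClique e f) A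

  IsAlphaPrime : ℕ → Set
  IsAlphaPrime k = (∃ λ A → IndepEdges A × length A ≡ k)
                 × (∀ A → IndepEdges A → length A ≤ k)

  Stable : List (Fin n) → Set
  Stable W = AllPairs (λ x y → x ≢ y × ¬ Adj x y) W

  -- independent set of vertices in the sense of the paper: nonempty
  IndepVertices : List (Fin n) → Set
  IndepVertices W = Stable W × (W ≢ [])

  InNbhd : Fin n → List (Fin n) → Set
  InNbhd x W = All (Adj x) W

  -- d'(x) = α(G[N(x)]) = m
  IsDPrime : Fin n → ℕ → Set
  IsDPrime x m = (∃ λ W → InNbhd x W × Stable W × length W ≡ m)
               × (∀ W → InNbhd x W → Stable W → length W ≤ m)

  IsMaxWeightIndep : (Fin n → ℕ) → ℕ → Set
  IsMaxWeightIndep d k = (∃ λ W → IndepVertices W × sum (map d W) ≡ k)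
                       × (∀ W → IndepVertices W → sum (map d W) ≤ k)

-- For a stable set W, joining every w ∈ W to a maximum stable set of neighbours gives Σ d′(w)
-- independent edges in any graph: two of these edges at w have nonadjacent far ends, and edges at
-- different vertices of W would put two nonadjacent vertices into a common clique.
--
-- Conversely, a cograph has a cotree: every vertex set with two or more vertices splits into two
-- parts that are completely nonadjacent or completely adjacent to each other. Climbing the cotree,
-- each edge of an independent set A is charged to a vertex w of a stable set W so that the far ends
-- of the edges charged to w are distinct, nonadjacent neighbours of w; hence |A| ≤ Σ_{w ∈ W} d′(w).
-- The induction treats a part H together with a set X of vertices adjacent to all of H, which
-- receives the far ends of edges leaving H; at join nodes it uses that cographs are perfect.
module Submission where

open import Defs
open import Data.Nat using (ℕ; suc)
open import Data.Fin using (Fin)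
open import Function.Bundles using (_⇔_)

open import Data.Bool using (Bool; true; false; not; if_then_else_; T)
open import Data.Bool.Properties using (not-¬; ¬-not; T-≡) renaming (_≟_ to _≟ᵇ_)
open import Data.Empty using (⊥; ⊥-elim)
open import Data.Fin using (zero; suc; inject≤)
open import Data.Fin.Properties using (_≟_; <-cmp; inject≤-injective; any?)
open import Data.Vec.Base using (_∷_; here; there; tabulate)
import Data.Vec.Properties as Vec
open import Data.Fin.Subset using (Subset; ⁅_⁆; _∪_; _─_; _-_; Nonempty; ∣_∣)
  renaming (⊤ to full; ⊥ to ∅; _∈_ to _∈ₛ_; _∉_ to _∉ₛ_; _⊆_ to _⊆ₛ_; _⊂_ to _⊂ₛ_)
open import Data.Fin.Subset.Properties
  using ( ∈⊤; ∉⊥; x∈⁅x⁆; x∈⁅y⁆⇒x≡y; x∈p∪q⁺; x∈p∪q⁻; p─q⊆p; x∈p∧x∉q⇒x∈p─q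
        ; x∈p∧x≢y⇒x∈p-y; x∈p⇒p-x⊂p; ⊆-antisym; p⊂q⇒∣p∣<∣q∣)
  renaming (_∈?_ to _∈ₛ?_)
open import Data.List using (List; []; _∷_; _++_; length; map; filter; lookup; deduplicate)
open import Data.List.Properties using (length-map; length-++)
open import Data.List.Membership.Propositional using (_∈_; find; lose)
open import Data.List.Membership.Propositional.Properties
  using ( ∈-++⁺ˡ; ∈-++⁺ʳ; ∈-++⁻; ∈-filter⁺; ∈-filter⁻; ∈-lookup; ∈-map⁺; ∈-map⁻
        ; ∈-deduplicate⁺; ∈-deduplicate⁻)
open import Data.List.Relation.Unary.Any as Any using (here; there; index)
open import Data.List.Relation.Unary.Any.Properties using (lookup-index)
open import Data.List.Relation.Unary.All as All using (All; []; _∷_)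
open import Data.List.Relation.Unary.AllPairs as AllPairs using (AllPairs; []; _∷_)
import Data.List.Relation.Unary.AllPairs.Properties as AllPairs
import Data.List.Relation.Unary.All.Properties as AllP
open import Data.List.Relation.Unary.Unique.Propositional using (Unique)
import Data.List.Relation.Unary.Unique.DecPropositional.Properties as UniqueDec
open import Data.Nat using (_≤_; _<_; z≤n; s≤s; _+_)
open import Data.Nat.Properties
  using (≤-refl; ≤-reflexive; ≤-trans; ≤-antisym; n≤1+n; +-mono-≤; +-suc; ≰⇒≥; _≤?_)
open import Data.Nat.ListAction using (sum)
open import Data.Nat.Induction using (<-wellFounded)
open import Data.Product using (∃; ∃₂; _×_; _,_; proj₁; proj₂)
open import Data.Sum as Sum using (_⊎_; inj₁; inj₂)
open import Function using (_∘_; _$_; id)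
open import Function.Bundles using (mk⇔; Equivalence)
open import Induction.WellFounded using (WellFounded; WfRec; module Subrelation)
  renaming (module All to WfAll)
import Relation.Binary.Construct.On as On
open import Relation.Binary.Definitions using (DecidableEquality; tri<; tri≈; tri>)
open import Relation.Binary.PropositionalEquality
open import Relation.Nullary using (¬_; Dec; yes; no; does; ¬?)
open import Relation.Nullary.Decidable as Dec
  using (_×-dec_; _⊎-dec_; toSum; dec-true; dec-false; decidable-stable)

module _ {A : Set} {R : A → A → Set} where

  AllPairs-∈ : (∀ {x y} → R x y → R y x) → ∀ {xs x y} → AllPairs R xs →
               x ∈ xs → y ∈ xs → x ≢ y → R x y
  AllPairs-∈ R-sym (_ ∷ _)   (here refl) (here refl) x≢y = ⊥-elim (x≢y refl)
  AllPairs-∈ R-sym (px ∷ _)  (here refl) (there y∈)  _   = All.lookup px y∈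
  AllPairs-∈ R-sym (px ∷ _)  (there x∈)  (here refl) _   = R-sym (All.lookup px x∈)
  AllPairs-∈ R-sym (_ ∷ pxs) (there x∈)  (there y∈)  x≢y = AllPairs-∈ R-sym pxs x∈ y∈ x≢y

  AllPairs-from-∈ : ∀ {xs} → Unique xs → (∀ {x y} → x ∈ xs → y ∈ xs → x ≢ y → R x y) →
                    AllPairs R xs
  AllPairs-from-∈ []       _ = []
  AllPairs-from-∈ (x∉ ∷ u) r =
    All.tabulate (λ y∈ → r (here refl) (there y∈) (All.lookup x∉ y∈))
    ∷ AllPairs-from-∈ u (λ p q → r (there p) (there q))

module _ {A : Set} where

  sum-map-mono : ∀ (f g : A → ℕ) {xs} → (∀ {x} → x ∈ xs → f x ≤ g x) →
                 sum (map f xs) ≤ sum (map g xs)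
  sum-map-mono f g {[]}     _   = z≤n
  sum-map-mono f g {x ∷ xs} f≤g = +-mono-≤ (f≤g (here refl)) (sum-map-mono f g (f≤g ∘ there))

  sum-map-mono-< : ∀ (f g : A → ℕ) {xs y} → (∀ {x} → x ∈ xs → f x ≤ g x) →
                   y ∈ xs → f y < g y → sum (map f xs) < sum (map g xs)
  sum-map-mono-< f g {x ∷ xs} f≤g (here refl) fy<gy =
    +-mono-≤ fy<gy (sum-map-mono f g (f≤g ∘ there))
  sum-map-mono-< f g {x ∷ xs} f≤g (there y∈)  fy<gy =
    ≤-trans (≤-reflexive (sym (+-suc (f x) _)))
            (+-mono-≤ (f≤g (here refl)) (sum-map-mono-< f g (f≤g ∘ there) y∈ fy<gy))

  lookup-injective : ∀ {xs : List A} → Unique xs → ∀ i j → lookup xs i ≡ lookup xs j → i ≡ j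
  lookup-injective (_ ∷ _)  zero    zero    _  = refl
  lookup-injective (x∉ ∷ _) zero    (suc j) eq = ⊥-elim (All.lookup x∉ (∈-lookup j) eq)
  lookup-injective (x∉ ∷ _) (suc i) zero    eq = ⊥-elim (All.lookup x∉ (∈-lookup i) (sym eq))
  lookup-injective (_ ∷ u)  (suc i) (suc j) eq = cong suc (lookup-injective u i j eq)

module Fibres {A B : Set} (_≟ᴮ_ : DecidableEquality B) (g : A → B) where

  fibre : List A → B → List A
  fibre as b = filter (λ a → g a ≟ᴮ b) as

  length≤sum-fibres : ∀ as (W : List B) → (∀ {a} → a ∈ as → g a ∈ W) →
                      length as ≤ sum (map (length ∘ fibre as) W)
  length≤sum-fibres []       W _    = z≤n
  length≤sum-fibres (a ∷ as) W g∈W =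
    ≤-trans (s≤s (length≤sum-fibres as W (g∈W ∘ there)))
            (sum-map-mono-< (length ∘ fibre as) (length ∘ fibre (a ∷ as)) (λ {w} _ → grows w)
                            (g∈W (here refl)) strict)
    where
    grows : ∀ w → length (fibre as w) ≤ length (fibre (a ∷ as) w)
    grows w with g a ≟ᴮ w
    ... | yes _ = n≤1+n _
    ... | no  _ = ≤-refl
    strict : length (fibre as (g a)) < length (fibre (a ∷ as) (g a))
    strict with g a ≟ᴮ g a
    ... | yes _   = ≤-refl
    ... | no  g≢g = ⊥-elim (g≢g refl)

module Embedding {A : Set} (_≟ᴬ_ : DecidableEquality A) (J I : List A) (J≤I : length J ≤ length I) where
  open import Data.List.Membership.DecPropositional _≟ᴬ_ using () renaming (_∈?_ to _∈ᴬ?_)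

  embed : A → A
  embed x with x ∈ᴬ? J
  ... | yes x∈J = lookup I (inject≤ (index x∈J) J≤I)
  ... | no  _   = x

  embed-∈ : ∀ {x} → x ∈ J → embed x ∈ I
  embed-∈ {x} x∈J with x ∈ᴬ? J
  ... | yes _   = ∈-lookup _
  ... | no  x∉J = ⊥-elim (x∉J x∈J)

  embed-injective : Unique I → ∀ {x y} → x ∈ J → y ∈ J → embed x ≡ embed y → x ≡ y
  embed-injective uI {x} {y} x∈J y∈J eq with x ∈ᴬ? J | y ∈ᴬ? J
  ... | yes p | yes q = begin
          x                   ≡⟨ lookup-index p ⟩
          lookup J (index p)  ≡⟨ cong (lookup J) index-p≡index-q ⟩
          lookup J (index q)  ≡⟨ sym (lookup-index q) ⟩
          y                   ∎
          where
          open ≡-Reasoning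
          index-p≡index-q : index p ≡ index q
          index-p≡index-q = inject≤-injective J≤I J≤I _ _ (lookup-injective uI _ _ eq)
  ... | no x∉J | _     = ⊥-elim (x∉J x∈J)
  ... | yes _  | no y∉J = ⊥-elim (y∉J y∈J)

module _ {A B : Set} {P : A → Set} (P? : ∀ x → Dec (P x)) where

  piecewise : (A → B) → (A → B) → A → B
  piecewise f g x = if does (P? x) then f x else g x

  piecewise-yes : ∀ f g {x} → P x → piecewise f g x ≡ f x
  piecewise-yes f g {x} px rewrite dec-true (P? x) px = refl

  piecewise-no : ∀ f g {x} → ¬ P x → piecewise f g x ≡ g x
  piecewise-no f g {x} ¬px rewrite dec-false (P? x) ¬px = refl

x∈p─q⇒x∉q : ∀ {n} {p q : Subset n} {x} → x ∈ₛ p ─ q → x ∉ₛ q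
x∈p─q⇒x∉q {p = _ ∷ _} {false ∷ _} here      ()
x∈p─q⇒x∉q {p = _ ∷ _} {false ∷ _} (there x∈) (there x∈q) = x∈p─q⇒x∉q x∈ x∈q
x∈p─q⇒x∉q {p = _ ∷ _} {true ∷ _}  (there x∈) (there x∈q) = x∈p─q⇒x∉q x∈ x∈q

module _ {n : ℕ} {P : Fin n → Set} (P? : ∀ x → Dec (P x)) where

  select : Subset n
  select = tabulate (does ∘ P?)

  ∈-select⁺ : ∀ {x} → P x → x ∈ₛ select
  ∈-select⁺ {x} px = Vec.lookup⇒[]= x _ (trans (Vec.lookup∘tabulate (does ∘ P?) x) (dec-true (P? x) px))

  ∈-select⁻ : ∀ {x} → x ∈ₛ select → P x
  ∈-select⁻ {x} x∈ with P? x | trans (sym (Vec.lookup∘tabulate (does ∘ P?) x)) (Vec.[]=⇒lookup x∈)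
  ... | yes px | _  = px
  ... | no  _  | ()

⊂-wellFounded : ∀ {n} → WellFounded (_⊂ₛ_ {n})
⊂-wellFounded = Subrelation.wellFounded p⊂q⇒∣p∣<∣q∣ (On.wellFounded ∣_∣ <-wellFounded)

module Basics {n : ℕ} (G : Graph n) where
  open Graph G using (adj; irrefl) renaming (sym to adj-comm)

  Adj-sym : ∀ {x y} → Adj G x y → Adj G y x
  Adj-sym {x} {y} = subst T (adj-comm x y)

  Adj⇒≢ : ∀ {x y} → Adj G x y → x ≢ y
  Adj⇒≢ {x} a refl = irrefl x a

  Adj⇒≡true : ∀ {x y} → Adj G x y → adj x y ≡ true
  Adj⇒≡true = Equivalence.to T-≡

  ≡true⇒Adj : ∀ {x y} → adj x y ≡ true → Adj G x y
  ≡true⇒Adj = Equivalence.from T-≡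

  ≡false⇒¬Adj : ∀ {x y} → adj x y ≡ false → ¬ Adj G x y
  ≡false⇒¬Adj x≁y a = not-¬ (Adj⇒≡true a) x≁y

  ≢false⇒Adj : ∀ {x y} → adj x y ≢ false → Adj G x y
  ≢false⇒Adj = ≡true⇒Adj ∘ ¬-not

  infix 4 _∼_
  _∼_ : Fin n → Fin n → Set
  x ∼ y = x ≡ y ⊎ Adj G x y

  ∼-sym : ∀ {x y} → x ∼ y → y ∼ x
  ∼-sym (inj₁ x≡y) = inj₁ (sym x≡y)
  ∼-sym (inj₂ a)   = inj₂ (Adj-sym a)

  clique-∼ : ∀ {S x y} → Clique G S → x ∈ S → y ∈ S → x ∼ y
  clique-∼ {x = x} {y} cl x∈ y∈ with x ≟ y
  ... | yes x≡y = inj₁ x≡y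
  ... | no  x≢y = inj₂ (proj₂ (AllPairs-∈ (λ (x≢y , a) → x≢y ∘ sym , Adj-sym a) cl x∈ y∈ x≢y))

  clique-of-∼ : ∀ {L} → AllPairs _∼_ L → Clique G (deduplicate _≟_ L)
  clique-of-∼ {L} pairwise =
    AllPairs-from-∈ (UniqueDec.deduplicate-! _≟_ L) λ x∈ y∈ x≢y → x≢y , adjacent x∈ y∈ x≢y
    where
    adjacent : ∀ {x y} → x ∈ deduplicate _≟_ L → y ∈ deduplicate _≟_ L → x ≢ y → Adj G x y
    adjacent x∈ y∈ x≢y
      with AllPairs-∈ ∼-sym pairwise (∈-deduplicate⁻ _≟_ L x∈) (∈-deduplicate⁻ _≟_ L y∈) x≢y
    ... | inj₁ x≡y = ⊥-elim (x≢y x≡y)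
    ... | inj₂ a   = a

  data Joins (e : Edge G) : Fin n → Fin n → Set where
    forward  : Joins e (e₁ G e) (e₂ G e)
    backward : Joins e (e₂ G e) (e₁ G e)

  Joins-swap : ∀ {e a b} → Joins e a b → Joins e b a
  Joins-swap forward  = backward
  Joins-swap backward = forward

  Joins-adj : ∀ {e a b} → Joins e a b → Adj G a b
  Joins-adj {_ , _ , _ , a} forward  = a
  Joins-adj {_ , _ , _ , a} backward = Adj-sym a

  module _ (P : Fin n → Set) where

    Joins-ends⁺ : ∀ {e a b} → Joins e a b → P a → P b → P (e₁ G e) × P (e₂ G e)
    Joins-ends⁺ forward  pa pb = pa , pb
    Joins-ends⁺ backward pa pb = pb , pa

    Joins-ends⁻ : ∀ {e a b} → Joins e a b → P (e₁ G e) → P (e₂ G e) → P a × P b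
    Joins-ends⁻ forward  p₁ p₂ = p₁ , p₂
    Joins-ends⁻ backward p₁ p₂ = p₂ , p₁

  commonClique : ∀ {e f a b c d} → Joins e a b → Joins f c d →
                 a ∼ c → a ∼ d → b ∼ c → b ∼ d → CommonClique G e f
  commonClique {e} {f} {a} {b} {c} {d} je jf ac ad bc bd =
    S , clique-of-∼ pairwise , proj₁ ends-e , proj₂ ends-e , proj₁ ends-f , proj₂ ends-f
    where
    L S : List (Fin n)
    L = a ∷ b ∷ c ∷ d ∷ []
    S = deduplicate _≟_ L
    pairwise : AllPairs _∼_ L
    pairwise = (inj₂ (Joins-adj je) ∷ ac ∷ ad ∷ []) ∷ (bc ∷ bd ∷ [])
             ∷ (inj₂ (Joins-adj jf) ∷ []) ∷ [] ∷ []
    inS : ∀ {x} → x ∈ L → x ∈ S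
    inS = ∈-deduplicate⁺ _≟_
    ends-e : e₁ G e ∈ S × e₂ G e ∈ S
    ends-e = Joins-ends⁺ (_∈ S) je (inS (here refl)) (inS (there (here refl)))
    ends-f : e₁ G f ∈ S × e₂ G f ∈ S
    ends-f = Joins-ends⁺ (_∈ S) jf (inS (there (there (here refl)))) (inS (there (there (there (here refl)))))

  commonClique⇒∼ : ∀ {e f a b c d} → CommonClique G e f → Joins e a b → Joins f c d → a ∼ c
  commonClique⇒∼ (S , cl , e₁∈ , e₂∈ , f₁∈ , f₂∈) je jf =
    clique-∼ cl (proj₁ (Joins-ends⁻ (_∈ S) je e₁∈ e₂∈))
                (proj₁ (Joins-ends⁻ (_∈ S) jf f₁∈ f₂∈))

  CommonClique-sym : ∀ {e f} → CommonClique G e f → CommonClique G f e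
  CommonClique-sym (S , cl , e₁∈ , e₂∈ , f₁∈ , f₂∈) = S , cl , f₁∈ , f₂∈ , e₁∈ , e₂∈

  CommonClique-refl : ∀ e → CommonClique G e e
  CommonClique-refl e =
    commonClique {e} {e} forward forward (inj₁ refl) (inj₂ (Joins-adj {e} forward))
                 (inj₂ (Joins-adj {e} backward)) (inj₁ refl)

  IndepEdges⇒Unique : ∀ {A} → IndepEdges G A → Unique A
  IndepEdges⇒Unique = AllPairs.map λ {e} ¬cc e≡f → ¬cc (subst (CommonClique G e) e≡f (CommonClique-refl e))

  conflict : ∀ {A e f a b c d} → IndepEdges G A → e ∈ A → f ∈ A → e ≢ f →
             Joins e a b → Joins f c d → a ∼ c → a ∼ d → b ∼ c → b ∼ d → ⊥
  conflict indA e∈ f∈ e≢f je jf ac ad bc bd =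
    AllPairs-∈ {R = λ e f → ¬ CommonClique G e f} (λ {e} {f} ¬cc → ¬cc ∘ CommonClique-sym {f} {e})
               indA e∈ f∈ e≢f (commonClique je jf ac ad bc bd)

  edge : ∀ {w s} → Adj G w s → Edge G
  edge {w} {s} a with <-cmp w s
  ... | tri< w<s _ _ = w , s , w<s , a
  ... | tri≈ _ w≡s _ = ⊥-elim (Adj⇒≢ a w≡s)
  ... | tri> _ _ s<w = s , w , s<w , Adj-sym a

  edge-joins : ∀ {w s} (a : Adj G w s) → Joins (edge a) w s
  edge-joins {w} {s} a with <-cmp w s
  ... | tri< _ _ _   = forward
  ... | tri≈ _ w≡s _ = ⊥-elim (Adj⇒≢ a w≡s)
  ... | tri> _ _ _   = backward

  star : ∀ {w S} → All (Adj G w) S → List (Edge G)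
  star []       = []
  star (a ∷ as) = edge a ∷ star as

  length-star : ∀ {w S} (as : All (Adj G w) S) → length (star as) ≡ length S
  length-star []       = refl
  length-star (_ ∷ as) = cong suc (length-star as)

  star-joins : ∀ {w S e} (as : All (Adj G w) S) → e ∈ star as → ∃ λ s → s ∈ S × Joins e w s
  star-joins (a ∷ _)  (here refl) = _ , here refl , edge-joins a
  star-joins (_ ∷ as) (there e∈)  with star-joins as e∈
  ... | s , s∈ , je = s , there s∈ , je

  star-independent : ∀ {w S} (as : All (Adj G w) S) → Stable G S → IndepEdges G (star as)
  star-independent []       []         = []
  star-independent (a ∷ as) (ps ∷ st) = All.tabulate apart ∷ star-independent as st
    where
    apart : ∀ {f} → f ∈ star as → ¬ CommonClique G (edge a) f
    apart f∈ cc with star-joins as f∈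
    ... | s′ , s′∈ , jf
      with commonClique⇒∼ cc (Joins-swap (edge-joins a)) (Joins-swap jf) | All.lookup ps s′∈
    ...   | inj₁ s≡s′ | s≢s′ , _ = s≢s′ s≡s′
    ...   | inj₂ s~s′ | _ , s≁s′ = s≁s′ s~s′

module LowerBound {n : ℕ} (G : Graph n) (d : Fin n → ℕ) (d′ : ∀ x → IsDPrime G x (d x)) where
  open Basics G

  fan : Fin n → List (Edge G)
  fan w with proj₁ (d′ w)
  ... | _ , nbhd , _ = star nbhd

  length-fan : ∀ w → length (fan w) ≡ d w
  length-fan w with proj₁ (d′ w)
  ... | _ , nbhd , _ , |S|≡d = trans (length-star nbhd) |S|≡d

  fan-joins : ∀ {w e} → e ∈ fan w → ∃ λ s → Joins e w s
  fan-joins {w} e∈ with proj₁ (d′ w)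
  ... | _ , nbhd , _ = let (s , _ , je) = star-joins nbhd e∈ in s , je

  fan-independent : ∀ w → IndepEdges G (fan w)
  fan-independent w with proj₁ (d′ w)
  ... | _ , nbhd , stable , _ = star-independent nbhd stable

  fans : List (Fin n) → List (Edge G)
  fans []      = []
  fans (w ∷ W) = fan w ++ fans W

  length-fans : ∀ W → length (fans W) ≡ sum (map d W)
  length-fans []      = refl
  length-fans (w ∷ W) = trans (length-++ (fan w)) (cong₂ _+_ (length-fan w) (length-fans W))

  fans-joins : ∀ {W e} → e ∈ fans W → ∃₂ λ w s → w ∈ W × Joins e w s
  fans-joins {w ∷ W} e∈ with ∈-++⁻ (fan w) e∈
  ... | inj₁ e∈fan  = let (s , je) = fan-joins e∈fan in w , s , here refl , je
  ... | inj₂ e∈fans = let (w′ , s , w′∈ , je) = fans-joins e∈fans in w′ , s , there w′∈ , je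

  fans-independent : ∀ {W} → Stable G W → IndepEdges G (fans W)
  fans-independent {[]}    []         = []
  fans-independent {w ∷ W} (pw ∷ st) =
    AllPairs.++⁺ (fan-independent w) (fans-independent st)
                 (All.tabulate λ e∈ → All.tabulate λ f∈ → apart e∈ f∈)
    where
    apart : ∀ {e f} → e ∈ fan w → f ∈ fans W → ¬ CommonClique G e f
    apart e∈ f∈ cc with fan-joins e∈ | fans-joins f∈
    ... | _ , je | w′ , _ , w′∈ , jf with commonClique⇒∼ cc je jf | All.lookup pw w′∈
    ...   | inj₁ w≡w′ | w≢w′ , _ = w≢w′ w≡w′
    ...   | inj₂ w~w′ | _ , w≁w′ = w≁w′ w~w′

module Cotrees {n : ℕ} (G : Graph n) where
  open Graph G using (adj) renaming (sym to adj-comm)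
  open Basics G

  record Split (b : Bool) (S S₁ S₂ : Subset n) : Set where
    field
      cover    : ∀ {x} → x ∈ₛ S → x ∈ₛ S₁ ⊎ x ∈ₛ S₂
      ⊆₁       : S₁ ⊆ₛ S
      ⊆₂       : S₂ ⊆ₛ S
      disjoint : ∀ {x} → x ∈ₛ S₁ → x ∉ₛ S₂
      between  : ∀ {x y} → x ∈ₛ S₁ → y ∈ₛ S₂ → adj x y ≡ b

  Split-swap : ∀ {b S S₁ S₂} → Split b S S₁ S₂ → Split b S S₂ S₁
  Split-swap sp = record
    { cover    = Sum.swap ∘ cover
    ; ⊆₁       = ⊆₂
    ; ⊆₂       = ⊆₁
    ; disjoint = λ x∈₂ x∈₁ → disjoint x∈₁ x∈₂
    ; between  = λ x∈₂ y∈₁ → trans (adj-comm _ _) (between y∈₁ x∈₂)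
    }
    where open Split sp

  Split-⊂₂ : ∀ {b S S₁ S₂} → Split b S S₁ S₂ → Nonempty S₁ → S₂ ⊂ₛ S
  Split-⊂₂ sp (w , w∈₁) = ⊆₂ , w , ⊆₁ w∈₁ , disjoint w∈₁
    where open Split sp

  Split-⊂₁ : ∀ {b S S₁ S₂} → Split b S S₁ S₂ → Nonempty S₂ → S₁ ⊂ₛ S
  Split-⊂₁ = Split-⊂₂ ∘ Split-swap

  Split-∉₁ : ∀ {b S S₁ S₂ x} → Split b S S₁ S₂ → x ∈ₛ S₂ → x ∉ₛ S₁
  Split-∉₁ sp x∈₂ x∈₁ = Split.disjoint sp x∈₁ x∈₂

  Split-≢ : ∀ {b S S₁ S₂ x y} → Split b S S₁ S₂ → x ∈ₛ S₁ → y ∈ₛ S₂ → x ≢ y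
  Split-≢ sp x∈₁ y∈₂ refl = Split.disjoint sp x∈₁ y∈₂

  Split-regroup : ∀ {b S S₁ S₂ X x} → Split b S S₁ S₂ → x ∈ₛ S ∪ X → x ∈ₛ S₁ ∪ (S₂ ∪ X)
  Split-regroup {S = S} {X = X} sp x∈ with x∈p∪q⁻ S X x∈
  ... | inj₂ x∈X = x∈p∪q⁺ (inj₂ (x∈p∪q⁺ (inj₂ x∈X)))
  ... | inj₁ x∈S with Split.cover sp x∈S
  ...   | inj₁ x∈₁ = x∈p∪q⁺ (inj₁ x∈₁)
  ...   | inj₂ x∈₂ = x∈p∪q⁺ (inj₂ (x∈p∪q⁺ (inj₁ x∈₂)))

  stable-++ : ∀ {S S₁ S₂ W₁ W₂} → Split false S S₁ S₂ → Stable G W₁ → Stable G W₂ →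
              All (_∈ₛ S₁) W₁ → All (_∈ₛ S₂) W₂ → Stable G (W₁ ++ W₂)
  stable-++ {S₁ = S₁} {S₂} sp st₁ st₂ W₁⊆ W₂⊆ =
    AllPairs.++⁺ st₁ st₂ (All.map (λ x∈₁ → All.map (λ y∈₂ → apart x∈₁ y∈₂) W₂⊆) W₁⊆)
    where
    open Split sp
    apart : ∀ {x y} → x ∈ₛ S₁ → y ∈ₛ S₂ → x ≢ y × ¬ Adj G x y
    apart x∈₁ y∈₂ = (λ { refl → disjoint x∈₁ y∈₂ }) , ≡false⇒¬Adj (between x∈₁ y∈₂)

  data Cotree (S : Subset n) : Set where
    leaf : ∀ v → S ≡ ⁅ v ⁆ → Cotree S
    node : ∀ {b S₁ S₂} → Split b S S₁ S₂ → Cotree S₁ → Cotree S₂ → Cotree S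

  Cotree-nonempty : ∀ {S} → Cotree S → Nonempty S
  Cotree-nonempty (leaf v refl)  = v , x∈⁅x⁆ v
  Cotree-nonempty (node sp t₁ _) with Cotree-nonempty t₁
  ... | w , w∈ = w , Split.⊆₁ sp w∈

  module Construction (cograph : Cograph G) where

    P₄-free : ∀ {a b c d} → Adj G a b → Adj G b c → Adj G c d →
              ¬ Adj G a c → ¬ Adj G b d → ¬ Adj G a d → ⊥
    P₄-free ab bc cd ¬ac ¬bd ¬ad =
      cograph _ _ _ _ (Adj⇒≢ ab) (λ { refl → ¬ad cd }) (λ { refl → ¬bd (Adj-sym ab) })
              (Adj⇒≢ bc) (λ { refl → ¬ad ab }) (Adj⇒≢ cd) ab bc cd ¬ac ¬bd ¬ad

    no-P₄ : ∀ b {p q r s} → adj p q ≡ b → adj q r ≡ b → adj r s ≡ b →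
            adj p r ≢ b → adj q s ≢ b → adj p s ≢ b → ⊥
    no-P₄ true  pq qr rs pr qs ps =
      P₄-free (≡true⇒Adj pq) (≡true⇒Adj qr) (≡true⇒Adj rs)
              (pr ∘ Adj⇒≡true) (qs ∘ Adj⇒≡true) (ps ∘ Adj⇒≡true)
    -- the complement of the path p q r s is the path q s p r
    no-P₄ false pq qr rs pr qs ps =
      P₄-free (≢false⇒Adj qs) (Adj-sym (≢false⇒Adj ps)) (≢false⇒Adj pr)
              (≡false⇒¬Adj pq ∘ Adj-sym) (≡false⇒¬Adj rs ∘ Adj-sym) (≡false⇒¬Adj qr)

    -- Otherwise x y v w is an induced path in the graph with adjacency adj · · ≡ not c.
    same-side : ∀ {c D T₁ T₂ v w x y} → Split c D T₁ T₂ → w ∈ₛ T₂ → adj v w ≡ not c →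
                x ∈ₛ T₁ → y ∈ₛ T₁ → adj v x ≡ c → adj v y ≡ not c → adj x y ≡ c
    same-side {c} {v = v} {w} {x} {y} sp w∈ vw x∈ y∈ vx vy with adj x y ≟ᵇ c
    ... | yes xy = xy
    ... | no  xy = ⊥-elim (no-P₄ (not c) (¬-not xy) (trans (adj-comm y v) vy) vw
                                 (not-¬ (trans (adj-comm x v) vx)) (not-¬ (between y∈ w∈))
                                 (not-¬ (between x∈ w∈)))
      where open Split sp

    module Insert {S v} (v∈S : v ∈ₛ S)
                  (recurse : ∀ {S′} → S′ ⊂ₛ S → Nonempty S′ → Cotree S′) where

      D : Subset n
      D = S - v

      D⊆S : D ⊆ₛ S
      D⊆S = p─q⊆p S ⁅ v ⁆

      ∈D⇒≢ : ∀ {x} → x ∈ₛ D → x ≢ v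
      ∈D⇒≢ x∈D refl = x∈p─q⇒x∉q x∈D (x∈⁅x⁆ v)

      ∈S-cases : ∀ {x} → x ∈ₛ S → x ≡ v ⊎ x ∈ₛ D
      ∈S-cases {x} x∈S with x ≟ v
      ... | yes x≡v = inj₁ x≡v
      ... | no  x≢v = inj₂ (x∈p∧x≢y⇒x∈p-y x∈S x≢v)

      ∈∪v-cases : ∀ {T x} → x ∈ₛ T ∪ ⁅ v ⁆ → x ∈ₛ T ⊎ x ≡ v
      ∈∪v-cases {T} x∈ = Sum.map₂ (x∈⁅y⁆⇒x≡y v) (x∈p∪q⁻ T ⁅ v ⁆ x∈)

      v∈∪v : ∀ {T} → v ∈ₛ T ∪ ⁅ v ⁆
      v∈∪v = x∈p∪q⁺ (inj₂ (x∈⁅x⁆ v))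

      split-apex : ∀ {b} → (∀ {x} → x ∈ₛ D → adj v x ≡ b) → Split b S ⁅ v ⁆ D
      split-apex {b} v-D = record
        { cover    = Sum.map₁ (λ { refl → x∈⁅x⁆ v }) ∘ ∈S-cases
        ; ⊆₁       = λ x∈ → subst (_∈ₛ S) (sym (x∈⁅y⁆⇒x≡y v x∈)) v∈S
        ; ⊆₂       = D⊆S
        ; disjoint = λ x∈ x∈D → ∈D⇒≢ x∈D (x∈⁅y⁆⇒x≡y v x∈)
        ; between  = λ x∈ y∈D → subst (λ u → adj u _ ≡ b) (sym (x∈⁅y⁆⇒x≡y v x∈)) (v-D y∈D)
        }

      split-extend : ∀ {c T₁ T₂} → Split c D T₁ T₂ → (∀ {x} → x ∈ₛ T₁ → adj v x ≡ c) →
                     Split c S T₁ (T₂ ∪ ⁅ v ⁆)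
      split-extend {c} {T₁} {T₂} sp v-T₁ = record
        { cover    = cover′
        ; ⊆₁       = D⊆S ∘ ⊆₁
        ; ⊆₂       = ⊆₂′
        ; disjoint = disjoint′
        ; between  = between′
        }
        where
        open Split sp
        cover′ : ∀ {x} → x ∈ₛ S → x ∈ₛ T₁ ⊎ x ∈ₛ T₂ ∪ ⁅ v ⁆
        cover′ x∈S with ∈S-cases x∈S
        ... | inj₁ refl = inj₂ v∈∪v
        ... | inj₂ x∈D  = Sum.map₂ (x∈p∪q⁺ ∘ inj₁) (cover x∈D)
        ⊆₂′ : T₂ ∪ ⁅ v ⁆ ⊆ₛ S
        ⊆₂′ x∈ with ∈∪v-cases x∈
        ... | inj₁ x∈₂  = D⊆S (⊆₂ x∈₂)
        ... | inj₂ refl = v∈S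
        disjoint′ : ∀ {x} → x ∈ₛ T₁ → x ∉ₛ T₂ ∪ ⁅ v ⁆
        disjoint′ x∈₁ x∈ with ∈∪v-cases x∈
        ... | inj₁ x∈₂  = disjoint x∈₁ x∈₂
        ... | inj₂ refl = ∈D⇒≢ (⊆₁ x∈₁) refl
        between′ : ∀ {x y} → x ∈ₛ T₁ → y ∈ₛ T₂ ∪ ⁅ v ⁆ → adj x y ≡ c
        between′ x∈₁ y∈ with ∈∪v-cases y∈
        ... | inj₁ y∈₂  = between x∈₁ y∈₂
        ... | inj₂ refl = trans (adj-comm _ v) (v-T₁ x∈₁)

      uniform-or-deviant : ∀ b T →
                           (∀ {x} → x ∈ₛ T → adj v x ≡ b) ⊎ (∃ λ y → y ∈ₛ T × adj v y ≡ not b)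
      uniform-or-deviant b T with any? (λ x → x ∈ₛ? T ×-dec adj v x ≟ᵇ not b)
      ... | yes deviant = inj₂ deviant
      ... | no  none    = inj₁ λ {x} x∈ → decidable-stable (adj v x ≟ᵇ b) λ ne → none (x , x∈ , ¬-not ne)

      -- If v sees both sides of the c-split of D somewhere through not c, the vertices of D that v
      -- sees through c form one part of a c-split of S.
      module Resplit {c T₁ T₂ y₁ y₂} (sp : Split c D T₁ T₂)
                     (y₁∈ : y₁ ∈ₛ T₁) (vy₁ : adj v y₁ ≡ not c)
                     (y₂∈ : y₂ ∈ₛ T₂) (vy₂ : adj v y₂ ≡ not c) where

        in-B? : ∀ x → Dec (x ∈ₛ D × adj v x ≡ c)
        in-B? x = x ∈ₛ? D ×-dec adj v x ≟ᵇ c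

        B C : Subset n
        B = select in-B?
        C = S ─ B

        v∈C : v ∈ₛ C
        v∈C = x∈p∧x∉q⇒x∈p─q v∈S λ v∈B → ∈D⇒≢ (proj₁ (∈-select⁻ in-B? v∈B)) refl

        ∈C⇒≡not : ∀ {y} → y ∈ₛ C → y ∈ₛ D → adj v y ≡ not c
        ∈C⇒≡not y∈C y∈D = ¬-not λ vy≡c → x∈p─q⇒x∉q y∈C (∈-select⁺ in-B? (y∈D , vy≡c))

        split : Split c S B C
        split = record
          { cover    = cover′
          ; ⊆₁       = D⊆S ∘ proj₁ ∘ ∈-select⁻ in-B?
          ; ⊆₂       = p─q⊆p S B
          ; disjoint = λ x∈B x∈C → x∈p─q⇒x∉q x∈C x∈B
          ; between  = between′
          }
          where
          open Split sp
          cover′ : ∀ {x} → x ∈ₛ S → x ∈ₛ B ⊎ x ∈ₛ C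
          cover′ {x} x∈S with x ∈ₛ? B
          ... | yes x∈B = inj₁ x∈B
          ... | no  x∉B = inj₂ (x∈p∧x∉q⇒x∈p─q x∈S x∉B)
          between′ : ∀ {x y} → x ∈ₛ B → y ∈ₛ C → adj x y ≡ c
          between′ {x} {y} x∈B y∈C with ∈-select⁻ in-B? x∈B | ∈S-cases (p─q⊆p S B y∈C)
          ... | _ , vx | inj₁ refl = trans (adj-comm x v) vx
          ... | x∈D , vx | inj₂ y∈D with cover x∈D | cover y∈D
          ...   | inj₁ x∈₁ | inj₂ y∈₂ = between x∈₁ y∈₂
          ...   | inj₂ x∈₂ | inj₁ y∈₁ = trans (adj-comm x y) (between y∈₁ x∈₂)
          ...   | inj₁ x∈₁ | inj₁ y∈₁ = same-side sp y₂∈ vy₂ x∈₁ y∈₁ vx (∈C⇒≡not y∈C y∈D)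
          ...   | inj₂ x∈₂ | inj₂ y∈₂ =
            same-side (Split-swap sp) y₁∈ vy₁ x∈₂ y∈₂ vx (∈C⇒≡not y∈C y∈D)

        cotree : Cotree D → Cotree S
        cotree tD with any? (_∈ₛ? B)
        ... | no  B-empty    =
          node (split-apex λ {x} x∈D → ¬-not λ vx → B-empty (x , ∈-select⁺ in-B? (x∈D , vx))) (leaf v refl) tD
        ... | yes B-nonempty =
          node split (recurse (Split-⊂₁ split (v , v∈C)) B-nonempty)
                     (recurse (Split-⊂₂ split B-nonempty) (v , v∈C))

      insert : Cotree D → Cotree S
      insert tD@(leaf u D≡⁅u⁆) =
        node (split-apex λ x∈D → cong (adj v) (x∈⁅y⁆⇒x≡y u (subst (_ ∈ₛ_) D≡⁅u⁆ x∈D)))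
             (leaf v refl) tD
      insert tD@(node {c} {T₁} {T₂} sp t₁ t₂) with uniform-or-deviant c T₁ | uniform-or-deviant c T₂
      ... | inj₁ v-T₁ | _ =
        node sp′ t₁ (recurse (Split-⊂₂ sp′ (Cotree-nonempty t₁)) (v , v∈∪v))
        where
        sp′ : Split c S T₁ (T₂ ∪ ⁅ v ⁆)
        sp′ = split-extend sp v-T₁
      ... | inj₂ _ | inj₁ v-T₂ =
        node sp′ t₂ (recurse (Split-⊂₂ sp′ (Cotree-nonempty t₂)) (v , v∈∪v))
        where
        sp′ : Split c S T₂ (T₁ ∪ ⁅ v ⁆)
        sp′ = split-extend (Split-swap sp) v-T₂
      ... | inj₂ (_ , y₁∈ , vy₁) | inj₂ (_ , y₂∈ , vy₂) = Resplit.cotree sp y₁∈ vy₁ y₂∈ vy₂ tD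

    cotree : ∀ S → Nonempty S → Cotree S
    cotree = WfAll.wfRec ⊂-wellFounded _ (λ S → Nonempty S → Cotree S) step
      where
      step : ∀ S → WfRec _⊂ₛ_ (λ S → Nonempty S → Cotree S) S → Nonempty S → Cotree S
      step S recurse (v , v∈S) with any? (_∈ₛ? (S - v))
      ... | yes D-nonempty = Insert.insert v∈S recurse (recurse (x∈p⇒p-x⊂p v∈S) D-nonempty)
      ... | no  D-empty    = leaf v (⊆-antisym S⊆⁅v⁆ ⁅v⁆⊆S)
        where
        S⊆⁅v⁆ : S ⊆ₛ ⁅ v ⁆
        S⊆⁅v⁆ {x} x∈S with x ≟ v
        ... | yes refl = x∈⁅x⁆ v
        ... | no  x≢v  = ⊥-elim (D-empty (x , x∈p∧x≢y⇒x∈p-y x∈S x≢v))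
        ⁅v⁆⊆S : ⁅ v ⁆ ⊆ₛ S
        ⁅v⁆⊆S x∈ = subst (_∈ₛ S) (sym (x∈⁅y⁆⇒x≡y v x∈)) v∈S

module CliqueCovers {n : ℕ} (G : Graph n) where
  open Basics G
  open Cotrees G

  -- A stable set W with a cover of S by |W| cliques (the fibres of π), so W is a maximum stable
  -- set: cographs are perfect.
  record CliqueCover (S : Subset n) : Set where
    field
      W      : List (Fin n)
      stable : Stable G W
      W⊆S    : All (_∈ₛ S) W
      π      : Fin n → Fin n
      π∈W    : ∀ {x} → x ∈ₛ S → π x ∈ W
      π-∼    : ∀ {x y} → x ∈ₛ S → y ∈ₛ S → π x ≡ π y → x ∼ y

  cover-leaf : ∀ v → CliqueCover ⁅ v ⁆
  cover-leaf v = record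
    { W      = v ∷ []
    ; stable = [] ∷ []
    ; W⊆S    = x∈⁅x⁆ v ∷ []
    ; π      = λ _ → v
    ; π∈W    = λ _ → here refl
    ; π-∼    = λ x∈ y∈ _ → inj₁ (trans (x∈⁅y⁆⇒x≡y v x∈) (sym (x∈⁅y⁆⇒x≡y v y∈)))
    }

  cover-union : ∀ {S S₁ S₂} → Split false S S₁ S₂ → CliqueCover S₁ → CliqueCover S₂ → CliqueCover S
  cover-union {S} {S₁} {S₂} sp C₁ C₂ = record
    { W      = C₁.W ++ C₂.W
    ; stable = stable-++ sp C₁.stable C₂.stable C₁.W⊆S C₂.W⊆S
    ; W⊆S    = AllP.++⁺ (All.map ⊆₁ C₁.W⊆S) (All.map ⊆₂ C₂.W⊆S)
    ; π      = π
    ; π∈W    = π∈W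
    ; π-∼    = π-∼
    }
    where
    module C₁ = CliqueCover C₁
    module C₂ = CliqueCover C₂
    open Split sp
    π : Fin n → Fin n
    π = piecewise (_∈ₛ? S₁) C₁.π C₂.π
    π₁ : ∀ {x} → x ∈ₛ S₁ → π x ≡ C₁.π x
    π₁ = piecewise-yes (_∈ₛ? S₁) C₁.π C₂.π
    π₂ : ∀ {x} → x ∈ₛ S₂ → π x ≡ C₂.π x
    π₂ = piecewise-no (_∈ₛ? S₁) C₁.π C₂.π ∘ Split-∉₁ sp
    π∈W : ∀ {x} → x ∈ₛ S → π x ∈ C₁.W ++ C₂.W
    π∈W x∈ with cover x∈
    ... | inj₁ x∈₁ = subst (_∈ _) (sym (π₁ x∈₁)) (∈-++⁺ˡ (C₁.π∈W x∈₁))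
    ... | inj₂ x∈₂ = subst (_∈ _) (sym (π₂ x∈₂)) (∈-++⁺ʳ C₁.W (C₂.π∈W x∈₂))
    crossing : ∀ {x y} → x ∈ₛ S₁ → y ∈ₛ S₂ → π x ≢ π y
    crossing x∈₁ y∈₂ eq =
      Split-≢ sp (All.lookup C₁.W⊆S (C₁.π∈W x∈₁)) (All.lookup C₂.W⊆S (C₂.π∈W y∈₂))
                 (trans (sym (π₁ x∈₁)) (trans eq (π₂ y∈₂)))
    π-∼ : ∀ {x y} → x ∈ₛ S → y ∈ₛ S → π x ≡ π y → x ∼ y
    π-∼ x∈ y∈ eq with cover x∈ | cover y∈
    ... | inj₁ x∈₁ | inj₁ y∈₁ = C₁.π-∼ x∈₁ y∈₁ (trans (sym (π₁ x∈₁)) (trans eq (π₁ y∈₁)))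
    ... | inj₂ x∈₂ | inj₂ y∈₂ = C₂.π-∼ x∈₂ y∈₂ (trans (sym (π₂ x∈₂)) (trans eq (π₂ y∈₂)))
    ... | inj₁ x∈₁ | inj₂ y∈₂ = ⊥-elim (crossing x∈₁ y∈₂ eq)
    ... | inj₂ x∈₂ | inj₁ y∈₁ = ⊥-elim (crossing y∈₁ x∈₂ (sym eq))

  -- The larger stable set survives; the cliques of the other side are merged injectively into
  -- its cliques, which is possible as every vertex of S₁ is adjacent to every vertex of S₂.
  cover-join : ∀ {S S₁ S₂} → Split true S S₁ S₂ → (C₁ : CliqueCover S₁) (C₂ : CliqueCover S₂) →
               length (CliqueCover.W C₂) ≤ length (CliqueCover.W C₁) → CliqueCover S
  cover-join {S} {S₁} {S₂} sp C₁ C₂ W₂≤W₁ = record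
    { W      = C₁.W
    ; stable = C₁.stable
    ; W⊆S    = All.map ⊆₁ C₁.W⊆S
    ; π      = π
    ; π∈W    = π∈W
    ; π-∼    = π-∼
    }
    where
    module C₁ = CliqueCover C₁
    module C₂ = CliqueCover C₂
    open Split sp
    open Embedding _≟_ C₂.W C₁.W W₂≤W₁
    π : Fin n → Fin n
    π = piecewise (_∈ₛ? S₁) C₁.π (embed ∘ C₂.π)
    π₁ : ∀ {x} → x ∈ₛ S₁ → π x ≡ C₁.π x
    π₁ = piecewise-yes (_∈ₛ? S₁) C₁.π (embed ∘ C₂.π)
    π₂ : ∀ {x} → x ∈ₛ S₂ → π x ≡ embed (C₂.π x)
    π₂ = piecewise-no (_∈ₛ? S₁) C₁.π (embed ∘ C₂.π) ∘ Split-∉₁ sp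
    π∈W : ∀ {x} → x ∈ₛ S → π x ∈ C₁.W
    π∈W x∈ with cover x∈
    ... | inj₁ x∈₁ = subst (_∈ C₁.W) (sym (π₁ x∈₁)) (C₁.π∈W x∈₁)
    ... | inj₂ x∈₂ = subst (_∈ C₁.W) (sym (π₂ x∈₂)) (embed-∈ (C₂.π∈W x∈₂))
    π-∼ : ∀ {x y} → x ∈ₛ S → y ∈ₛ S → π x ≡ π y → x ∼ y
    π-∼ x∈ y∈ eq with cover x∈ | cover y∈
    ... | inj₁ x∈₁ | inj₁ y∈₁ = C₁.π-∼ x∈₁ y∈₁ (trans (sym (π₁ x∈₁)) (trans eq (π₁ y∈₁)))
    ... | inj₁ x∈₁ | inj₂ y∈₂ = inj₂ (≡true⇒Adj (between x∈₁ y∈₂))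
    ... | inj₂ x∈₂ | inj₁ y∈₁ = inj₂ (Adj-sym (≡true⇒Adj (between y∈₁ x∈₂)))
    ... | inj₂ x∈₂ | inj₂ y∈₂ =
      C₂.π-∼ x∈₂ y∈₂ (embed-injective (AllPairs.map proj₁ C₁.stable) (C₂.π∈W x∈₂) (C₂.π∈W y∈₂)
                                      (trans (sym (π₂ x∈₂)) (trans eq (π₂ y∈₂))))

  cliqueCover : ∀ {S} → Cotree S → CliqueCover S
  cliqueCover (leaf v refl)           = cover-leaf v
  cliqueCover (node {false} sp t₁ t₂) = cover-union sp (cliqueCover t₁) (cliqueCover t₂)
  cliqueCover (node {true} sp t₁ t₂)
    with C₁ ← cliqueCover t₁ | C₂ ← cliqueCover t₂
    with length (CliqueCover.W C₂) ≤? length (CliqueCover.W C₁)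
  ... | yes W₂≤W₁ = cover-join sp C₁ C₂ W₂≤W₁
  ... | no  W₂≰W₁ = cover-join (Split-swap sp) C₂ C₁ (≰⇒≥ W₂≰W₁)

module Touching {n : ℕ} (G : Graph n) where
  open Basics G
  open Cotrees G

  data Touches (H : Subset n) (e : Edge G) : Set where
    touch₁ : e₁ G e ∈ₛ H → Touches H e
    touch₂ : e₂ G e ∈ₛ H → Touches H e

  touches? : ∀ H e → Dec (Touches H e)
  touches? H e = Dec.map′ Sum.[ touch₁ , touch₂ ]′ (λ { (touch₁ x) → inj₁ x ; (touch₂ x) → inj₂ x })
                          (e₁ G e ∈ₛ? H ⊎-dec e₂ G e ∈ₛ? H)

  touches-or-not : ∀ H e → Touches H e ⊎ ¬ Touches H e
  touches-or-not H e = toSum (touches? H e)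

  Joins-touches : ∀ {H e a b} → Joins e a b → a ∈ₛ H → Touches H e
  Joins-touches forward  a∈ = touch₁ a∈
  Joins-touches backward a∈ = touch₂ a∈

  Touches-other : ∀ {b H H₁ H₂ e} → Split b H H₁ H₂ → Touches H e → ¬ Touches H₁ e → Touches H₂ e
  Touches-other sp (touch₁ e₁∈) ¬t = touch₁ (Sum.[ ⊥-elim ∘ ¬t ∘ touch₁ , id ]′ (Split.cover sp e₁∈))
  Touches-other sp (touch₂ e₂∈) ¬t = touch₂ (Sum.[ ⊥-elim ∘ ¬t ∘ touch₂ , id ]′ (Split.cover sp e₂∈))

  Within : Subset n → Edge G → Set
  Within P e = e₁ G e ∈ₛ P × e₂ G e ∈ₛ P

  Counted : Subset n → Subset n → Edge G → Set
  Counted H X e = Touches H e × Within (H ∪ X) e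

  counted? : ∀ H X e → Dec (Counted H X e)
  counted? H X e = touches? H e ×-dec (e₁ G e ∈ₛ? H ∪ X ×-dec e₂ G e ∈ₛ? H ∪ X)

  orient : ∀ H e → ∃₂ λ a b → Joins e a b × (Touches H e → a ∈ₛ H)
  orient H e with e₁ G e ∈ₛ? H
  ... | yes e₁∈ = _ , _ , forward , λ _ → e₁∈
  ... | no  e₁∉ = _ , _ , backward , λ where
                    (touch₁ e₁∈) → ⊥-elim (e₁∉ e₁∈)
                    (touch₂ e₂∈) → e₂∈

  inEnd outEnd : Subset n → Edge G → Fin n
  inEnd  H e = proj₁ (orient H e)
  outEnd H e = proj₁ (proj₂ (orient H e))

  Joins-inEnd : ∀ H e → Joins e (inEnd H e) (outEnd H e)
  Joins-inEnd H e = proj₁ (proj₂ (proj₂ (orient H e)))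

  inEnd∈ : ∀ {H e} → Touches H e → inEnd H e ∈ₛ H
  inEnd∈ {H} {e} = proj₂ (proj₂ (proj₂ (orient H e)))

  outEnd∈ : ∀ {P Q e} → Within Q e → outEnd P e ∈ₛ Q
  outEnd∈ {P} {Q} {e} (e₁∈ , e₂∈) = proj₂ (Joins-ends⁻ (_∈ₛ Q) (Joins-inEnd P e) e₁∈ e₂∈)

  counted-join : ∀ {b H X H₁ H₂ e} → Split b H H₁ H₂ → Counted H X e → Touches H₁ e →
                 Counted H₁ (H₂ ∪ X) e
  counted-join sp (_ , e₁∈ , e₂∈) t = t , Split-regroup sp e₁∈ , Split-regroup sp e₂∈

  counted-union₁ : ∀ {H X H₁ H₂ e} → Split false H H₁ H₂ → Counted H X e → Touches H₁ e →
                   Counted H₁ X e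
  counted-union₁ {H} {X} {H₁} {H₂} {e} sp (_ , within) t =
    t , Joins-ends⁺ (_∈ₛ H₁ ∪ X) je (x∈p∪q⁺ (inj₁ (inEnd∈ t))) outEnd∈₁
    where
    je : Joins e (inEnd H₁ e) (outEnd H₁ e)
    je = Joins-inEnd H₁ e
    outEnd∈₁ : outEnd H₁ e ∈ₛ H₁ ∪ X
    outEnd∈₁ with x∈p∪q⁻ H X (outEnd∈ within)
    ... | inj₂ x∈X = x∈p∪q⁺ (inj₂ x∈X)
    ... | inj₁ x∈H with Split.cover sp x∈H
    ...   | inj₁ x∈₁ = x∈p∪q⁺ (inj₁ x∈₁)
    ...   | inj₂ x∈₂ = ⊥-elim (≡false⇒¬Adj (Split.between sp (inEnd∈ t) x∈₂) (Joins-adj je))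

  counted-union₂ : ∀ {H X H₁ H₂ e} → Split false H H₁ H₂ → Counted H X e → ¬ Touches H₁ e →
                   Counted H₂ X e
  counted-union₂ {H} {X} {H₁} {H₂} sp (t , e₁∈ , e₂∈) ¬t =
    Touches-other sp t ¬t , regroup e₁∈ (¬t ∘ touch₁) , regroup e₂∈ (¬t ∘ touch₂)
    where
    regroup : ∀ {x} → x ∈ₛ H ∪ X → x ∉ₛ H₁ → x ∈ₛ H₂ ∪ X
    regroup x∈ x∉₁ with x∈p∪q⁻ H₁ (H₂ ∪ X) (Split-regroup sp x∈)
    ... | inj₁ x∈₁ = ⊥-elim (x∉₁ x∈₁)
    ... | inj₂ x∈  = x∈

  Joined : Subset n → Subset n → Set
  Joined H X = ∀ {h x} → h ∈ₛ H → x ∈ₛ X → Adj G h x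

  Joined-disjoint : ∀ {H X x} → Joined H X → x ∈ₛ H → x ∉ₛ X
  Joined-disjoint joined x∈H x∈X = Adj⇒≢ (joined x∈H x∈X) refl

  Joined-across : ∀ {H X H₁ H₂} → Split true H H₁ H₂ → Joined H X → Joined H₁ (H₂ ∪ X)
  Joined-across {X = X} {H₂ = H₂} sp joined {x = y} h∈₁ y∈ with x∈p∪q⁻ H₂ X y∈
  ... | inj₁ y∈₂ = ≡true⇒Adj (Split.between sp h∈₁ y∈₂)
  ... | inj₂ y∈X = joined (Split.⊆₁ sp h∈₁) y∈X

module Charging {n : ℕ} (G : Graph n) {A : List (Edge G)} (indA : IndepEdges G A) where
  open Basics G
  open Cotrees G
  open CliqueCovers G
  open Touching G

  -- The partners of the edges owned by w ∈ W form a stable set of neighbours of w, so at most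
  -- d′(w) edges are owned by w.
  record Charge (H X : Subset n) : Set where
    field
      W              : List (Fin n)
      stable         : Stable G W
      W⊆H            : All (_∈ₛ H) W
      owner partner  : Edge G → Fin n
      owner∈W        : ∀ {e} → e ∈ A → Counted H X e → owner e ∈ W
      owner-adj      : ∀ {e} → e ∈ A → Counted H X e → Adj G (owner e) (partner e)
      partners-apart : ∀ {e f} → e ∈ A → f ∈ A → e ≢ f → Counted H X e → Counted H X f →
                       owner e ≡ owner f → ¬ partner e ∼ partner f

  ≁-resp : ∀ {p p′ q q′} → p ≡ p′ → q ≡ q′ → ¬ p′ ∼ q′ → ¬ p ∼ q
  ≁-resp refl refl ¬p∼q = ¬p∼q

  charge-leaf : ∀ v {X} → Charge ⁅ v ⁆ X
  charge-leaf v {X} = record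
    { W              = v ∷ []
    ; stable         = [] ∷ []
    ; W⊆H            = x∈⁅x⁆ v ∷ []
    ; owner          = λ _ → v
    ; partner        = outEnd ⁅ v ⁆
    ; owner∈W        = λ _ _ → here refl
    ; owner-adj      = λ _ c → Joins-adj (joins-v c)
    ; partners-apart = λ e∈ f∈ e≢f ce cf _ →
        conflict indA e∈ f∈ e≢f (joins-v ce) (joins-v cf) (inj₁ refl) (inj₂ (Joins-adj (joins-v cf)))
                 (inj₂ (Adj-sym (Joins-adj (joins-v ce))))
    }
    where
    joins-v : ∀ {e} → Counted ⁅ v ⁆ X e → Joins e v (outEnd ⁅ v ⁆ e)
    joins-v {e} (t , _) =
      subst (λ a → Joins e a (outEnd ⁅ v ⁆ e)) (x∈⁅y⁆⇒x≡y v (inEnd∈ t)) (Joins-inEnd ⁅ v ⁆ e)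

  charge-transfer : ∀ {H X H′ X′} → H′ ⊆ₛ H →
                    (∀ {e} → e ∈ A → Counted H X e → Counted H′ X′ e) → Charge H′ X′ → Charge H X
  charge-transfer H′⊆H restrict C = record
    { W              = W
    ; stable         = stable
    ; W⊆H            = All.map H′⊆H W⊆H
    ; owner          = owner
    ; partner        = partner
    ; owner∈W        = λ e∈ c → owner∈W e∈ (restrict e∈ c)
    ; owner-adj      = λ e∈ c → owner-adj e∈ (restrict e∈ c)
    ; partners-apart = λ e∈ f∈ e≢f ce cf → partners-apart e∈ f∈ e≢f (restrict e∈ ce) (restrict f∈ cf)
    }
    where open Charge C

  charge-union : ∀ {H X H₁ H₂} → Split false H H₁ H₂ → Charge H₁ X → Charge H₂ X → Charge H X
  charge-union {H} {X} {H₁} {H₂} sp C₁ C₂ = record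
    { W              = C₁.W ++ C₂.W
    ; stable         = stable-++ sp C₁.stable C₂.stable C₁.W⊆H C₂.W⊆H
    ; W⊆H            = AllP.++⁺ (All.map ⊆₁ C₁.W⊆H) (All.map ⊆₂ C₂.W⊆H)
    ; owner          = owner
    ; partner        = partner
    ; owner∈W        = owner∈W
    ; owner-adj      = owner-adj
    ; partners-apart = partners-apart
    }
    where
    module C₁ = Charge C₁
    module C₂ = Charge C₂
    open Split sp
    owner partner : Edge G → Fin n
    owner   = piecewise (touches? H₁) C₁.owner C₂.owner
    partner = piecewise (touches? H₁) C₁.partner C₂.partner
    owner₁ : ∀ {e} → Touches H₁ e → owner e ≡ C₁.owner e
    owner₁ = piecewise-yes (touches? H₁) C₁.owner C₂.owner
    owner₂ : ∀ {e} → ¬ Touches H₁ e → owner e ≡ C₂.owner e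
    owner₂ = piecewise-no (touches? H₁) C₁.owner C₂.owner
    partner₁ : ∀ {e} → Touches H₁ e → partner e ≡ C₁.partner e
    partner₁ = piecewise-yes (touches? H₁) C₁.partner C₂.partner
    partner₂ : ∀ {e} → ¬ Touches H₁ e → partner e ≡ C₂.partner e
    partner₂ = piecewise-no (touches? H₁) C₁.partner C₂.partner
    owner∈W : ∀ {e} → e ∈ A → Counted H X e → owner e ∈ C₁.W ++ C₂.W
    owner∈W {e} e∈ c with touches-or-not H₁ e
    ... | inj₁ t  = subst (_∈ _) (sym (owner₁ t)) (∈-++⁺ˡ (C₁.owner∈W e∈ (counted-union₁ sp c t)))
    ... | inj₂ ¬t = subst (_∈ _) (sym (owner₂ ¬t))
                          (∈-++⁺ʳ C₁.W (C₂.owner∈W e∈ (counted-union₂ sp c ¬t)))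
    owner-adj : ∀ {e} → e ∈ A → Counted H X e → Adj G (owner e) (partner e)
    owner-adj {e} e∈ c with touches-or-not H₁ e
    ... | inj₁ t  = subst₂ (Adj G) (sym (owner₁ t)) (sym (partner₁ t))
                           (C₁.owner-adj e∈ (counted-union₁ sp c t))
    ... | inj₂ ¬t = subst₂ (Adj G) (sym (owner₂ ¬t)) (sym (partner₂ ¬t))
                           (C₂.owner-adj e∈ (counted-union₂ sp c ¬t))
    crossing : ∀ {e f} → e ∈ A → f ∈ A → Counted H X e → Counted H X f →
               Touches H₁ e → ¬ Touches H₁ f → owner e ≢ owner f
    crossing e∈ f∈ ce cf te ¬tf eq =
      Split-≢ sp (All.lookup C₁.W⊆H (C₁.owner∈W e∈ (counted-union₁ sp ce te)))
                 (All.lookup C₂.W⊆H (C₂.owner∈W f∈ (counted-union₂ sp cf ¬tf)))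
                 (trans (sym (owner₁ te)) (trans eq (owner₂ ¬tf)))
    partners-apart : ∀ {e f} → e ∈ A → f ∈ A → e ≢ f → Counted H X e → Counted H X f →
                     owner e ≡ owner f → ¬ partner e ∼ partner f
    partners-apart {e} {f} e∈ f∈ e≢f ce cf eq with touches-or-not H₁ e | touches-or-not H₁ f
    ... | inj₁ te | inj₁ tf = ≁-resp (partner₁ te) (partner₁ tf) $
      C₁.partners-apart e∈ f∈ e≢f (counted-union₁ sp ce te) (counted-union₁ sp cf tf)
                        (trans (sym (owner₁ te)) (trans eq (owner₁ tf)))
    ... | inj₂ ¬te | inj₂ ¬tf = ≁-resp (partner₂ ¬te) (partner₂ ¬tf) $
      C₂.partners-apart e∈ f∈ e≢f (counted-union₂ sp ce ¬te) (counted-union₂ sp cf ¬tf)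
                        (trans (sym (owner₂ ¬te)) (trans eq (owner₂ ¬tf)))
    ... | inj₁ te  | inj₂ ¬tf = ⊥-elim (crossing e∈ f∈ ce cf te ¬tf eq)
    ... | inj₂ ¬te | inj₁ tf  = ⊥-elim (crossing f∈ e∈ cf ce tf ¬te (sym eq))

  -- Both sides carry counted edges avoiding the other side, so no counted edge lies inside Ha or Hb.
  -- An edge meeting Ha is charged to the Ca-centre of its end in Ha; an edge from Hb to X is charged
  -- through the Cb-centre of its end in Hb, embedded injectively into those Ca-centres that already
  -- own an edge from Ha to X (this needs the second list to be the longer one).
  module TwoSided {H X Ha Hb} (sp : Split true H Ha Hb) (joined : Joined H X)
                  (Ca : CliqueCover Ha) (Cb : CliqueCover Hb) where
    open Split sp
    module Ca = CliqueCover Ca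
    module Cb = CliqueCover Cb

    ToX : Subset n → Edge G → Set
    ToX P e = Counted H X e × Touches P e × outEnd P e ∈ₛ X

    toX? : ∀ P e → Dec (ToX P e)
    toX? P e = counted? H X e ×-dec touches? P e ×-dec outEnd P e ∈ₛ? X

    centres-aX centres-bX : List (Fin n)
    centres-aX = deduplicate _≟_ (map (Ca.π ∘ inEnd Ha) (filter (toX? Ha) A))
    centres-bX = deduplicate _≟_ (map (Cb.π ∘ inEnd Hb) (filter (toX? Hb) A))

    centres-aX-witness : ∀ {w} → w ∈ centres-aX → ∃ λ e → e ∈ A × ToX Ha e × Ca.π (inEnd Ha e) ≡ w
    centres-aX-witness w∈ with ∈-map⁻ (Ca.π ∘ inEnd Ha) (∈-deduplicate⁻ _≟_ _ w∈)
    ... | e , e∈ , refl with ∈-filter⁻ (toX? Ha) {xs = A} e∈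
    ...   | e∈A , toX = e , e∈A , toX , refl

    centres-aX⊆W : ∀ {w} → w ∈ centres-aX → w ∈ Ca.W
    centres-aX⊆W w∈ with centres-aX-witness w∈
    ... | _ , _ , (_ , t , _) , refl = Ca.π∈W (inEnd∈ t)

    across : ∀ {a y} → a ∈ₛ Ha → y ∈ₛ Hb ∪ X → Adj G a y
    across = Joined-across sp joined

    module _ (insideA-free : ∀ {e} → e ∈ A → Counted H X e → ¬ Within Ha e)
             (insideB-free : ∀ {e} → e ∈ A → Counted H X e → ¬ Within Hb e)
             (bX≤aX : length centres-bX ≤ length centres-aX) where
      open Embedding _≟_ centres-bX centres-aX bX≤aX

      a-side : ∀ {e} → e ∈ A → Counted H X e → Touches Ha e → outEnd Ha e ∈ₛ Hb ∪ X
      a-side {e} e∈ c@(_ , within) t with x∈p∪q⁻ H X (outEnd∈ within)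
      ... | inj₂ x∈X = x∈p∪q⁺ (inj₂ x∈X)
      ... | inj₁ x∈H with cover x∈H
      ...   | inj₁ x∈a =
        ⊥-elim (insideA-free e∈ c (Joins-ends⁺ (_∈ₛ Ha) (Joins-inEnd Ha e) (inEnd∈ t) x∈a))
      ...   | inj₂ x∈b = x∈p∪q⁺ (inj₁ x∈b)

      b-side : ∀ {e} → e ∈ A → Counted H X e → ¬ Touches Ha e → ToX Hb e
      b-side {e} e∈ c@(t , within) ¬ta = c , tb , outEnd∈X
        where
        tb : Touches Hb e
        tb = Touches-other sp t ¬ta
        outEnd∈X : outEnd Hb e ∈ₛ X
        outEnd∈X with x∈p∪q⁻ H X (outEnd∈ within)
        ... | inj₂ x∈X = x∈X
        ... | inj₁ x∈H with cover x∈H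
        ...   | inj₁ x∈a = ⊥-elim (¬ta (Joins-touches (Joins-swap (Joins-inEnd Hb e)) x∈a))
        ...   | inj₂ x∈b =
          ⊥-elim (insideB-free e∈ c (Joins-ends⁺ (_∈ₛ Hb) (Joins-inEnd Hb e) (inEnd∈ tb) x∈b))

      b-inEnd∈ : ∀ {e} → e ∈ A → Counted H X e → ¬ Touches Ha e → inEnd Hb e ∈ₛ Hb
      b-inEnd∈ e∈ c ¬ta = inEnd∈ (proj₁ (proj₂ (b-side e∈ c ¬ta)))

      b-outEnd∈ : ∀ {e} → e ∈ A → Counted H X e → ¬ Touches Ha e → outEnd Hb e ∈ₛ X
      b-outEnd∈ e∈ c ¬ta = proj₂ (proj₂ (b-side e∈ c ¬ta))

      centre-bX : ∀ {e} → e ∈ A → Counted H X e → ¬ Touches Ha e → Cb.π (inEnd Hb e) ∈ centres-bX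
      centre-bX e∈ c ¬ta =
        ∈-deduplicate⁺ _≟_ (∈-map⁺ (Cb.π ∘ inEnd Hb) (∈-filter⁺ (toX? Hb) e∈ (b-side e∈ c ¬ta)))

      owner partner : Edge G → Fin n
      owner   = piecewise (touches? Ha) (Ca.π ∘ inEnd Ha) (embed ∘ Cb.π ∘ inEnd Hb)
      partner = piecewise (touches? Ha) (outEnd Ha) (outEnd Hb)
      owner-a : ∀ {e} → Touches Ha e → owner e ≡ Ca.π (inEnd Ha e)
      owner-a = piecewise-yes (touches? Ha) (Ca.π ∘ inEnd Ha) (embed ∘ Cb.π ∘ inEnd Hb)
      owner-b : ∀ {e} → ¬ Touches Ha e → owner e ≡ embed (Cb.π (inEnd Hb e))
      owner-b = piecewise-no (touches? Ha) (Ca.π ∘ inEnd Ha) (embed ∘ Cb.π ∘ inEnd Hb)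
      partner-a : ∀ {e} → Touches Ha e → partner e ≡ outEnd Ha e
      partner-a = piecewise-yes (touches? Ha) (outEnd Ha) (outEnd Hb)
      partner-b : ∀ {e} → ¬ Touches Ha e → partner e ≡ outEnd Hb e
      partner-b = piecewise-no (touches? Ha) (outEnd Ha) (outEnd Hb)

      owner∈W : ∀ {e} → e ∈ A → Counted H X e → owner e ∈ Ca.W
      owner∈W {e} e∈ c with touches-or-not Ha e
      ... | inj₁ ta  = subst (_∈ Ca.W) (sym (owner-a ta)) (Ca.π∈W (inEnd∈ ta))
      ... | inj₂ ¬ta = subst (_∈ Ca.W) (sym (owner-b ¬ta)) (centres-aX⊆W (embed-∈ (centre-bX e∈ c ¬ta)))

      partner∈ : ∀ {e} → e ∈ A → Counted H X e → partner e ∈ₛ Hb ∪ X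
      partner∈ {e} e∈ c with touches-or-not Ha e
      ... | inj₁ ta  = subst (_∈ₛ Hb ∪ X) (sym (partner-a ta)) (a-side e∈ c ta)
      ... | inj₂ ¬ta = subst (_∈ₛ Hb ∪ X) (sym (partner-b ¬ta)) (x∈p∪q⁺ (inj₂ (b-outEnd∈ e∈ c ¬ta)))

      mixed : ∀ {e f} → e ∈ A → f ∈ A → e ≢ f → Counted H X e → Counted H X f →
              Touches Ha e → ¬ Touches Ha f → Ca.π (inEnd Ha e) ≡ embed (Cb.π (inEnd Hb f)) →
              ¬ outEnd Ha e ∼ outEnd Hb f
      mixed {e} {f} e∈ f∈ e≢f ce cf ta ¬tf eq p∼q with x∈p∪q⁻ Hb X (a-side e∈ ce ta)
      ... | inj₂ p∈X =
        conflict indA e∈ f∈ e≢f (Joins-inEnd Ha e) (Joins-inEnd Hb f)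
                 (inj₂ (across a∈ (x∈p∪q⁺ (inj₁ (b-inEnd∈ f∈ cf ¬tf)))))
                 (inj₂ (joined (⊆₁ a∈) (b-outEnd∈ f∈ cf ¬tf)))
                 (inj₂ (Adj-sym (joined (⊆₂ (b-inEnd∈ f∈ cf ¬tf)) p∈X))) p∼q
        where
        a∈ : inEnd Ha e ∈ₛ Ha
        a∈ = inEnd∈ ta
      -- the common centre owns an edge e′ from Ha to X, and e′, e lie in a common clique
      ... | inj₁ p∈Hb with centres-aX-witness (subst (_∈ centres-aX) (sym eq) (embed-∈ (centre-bX f∈ cf ¬tf)))
      ...   | e′ , e′∈ , (_ , t′ , x′∈X) , π′ =
        conflict indA e′∈ e∈ e′≢e (Joins-inEnd Ha e′) (Joins-inEnd Ha e)
                 (Ca.π-∼ (inEnd∈ t′) (inEnd∈ ta) π′)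
                 (inj₂ (across (inEnd∈ t′) (x∈p∪q⁺ (inj₁ p∈Hb))))
                 (inj₂ (Adj-sym (joined (⊆₁ (inEnd∈ ta)) x′∈X)))
                 (inj₂ (Adj-sym (joined (⊆₂ p∈Hb) x′∈X)))
        where
        e′≢e : e′ ≢ e
        e′≢e refl = Joined-disjoint joined (⊆₂ p∈Hb) x′∈X

      partners-apart : ∀ {e f} → e ∈ A → f ∈ A → e ≢ f → Counted H X e → Counted H X f →
                       owner e ≡ owner f → ¬ partner e ∼ partner f
      partners-apart {e} {f} e∈ f∈ e≢f ce cf eq with touches-or-not Ha e | touches-or-not Ha f
      ... | inj₁ te | inj₁ tf = ≁-resp (partner-a te) (partner-a tf) $
        conflict indA e∈ f∈ e≢f (Joins-inEnd Ha e) (Joins-inEnd Ha f)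
                 (Ca.π-∼ (inEnd∈ te) (inEnd∈ tf) (trans (sym (owner-a te)) (trans eq (owner-a tf))))
                 (inj₂ (across (inEnd∈ te) (a-side f∈ cf tf)))
                 (inj₂ (Adj-sym (across (inEnd∈ tf) (a-side e∈ ce te))))
      ... | inj₂ ¬te | inj₂ ¬tf = ≁-resp (partner-b ¬te) (partner-b ¬tf) $
        conflict indA e∈ f∈ e≢f (Joins-inEnd Hb e) (Joins-inEnd Hb f)
                 (Cb.π-∼ (b-inEnd∈ e∈ ce ¬te) (b-inEnd∈ f∈ cf ¬tf) same-centre)
                 (inj₂ (joined (⊆₂ (b-inEnd∈ e∈ ce ¬te)) (b-outEnd∈ f∈ cf ¬tf)))
                 (inj₂ (Adj-sym (joined (⊆₂ (b-inEnd∈ f∈ cf ¬tf)) (b-outEnd∈ e∈ ce ¬te))))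
        where
        same-centre : Cb.π (inEnd Hb e) ≡ Cb.π (inEnd Hb f)
        same-centre = embed-injective (UniqueDec.deduplicate-! _≟_ _) (centre-bX e∈ ce ¬te) (centre-bX f∈ cf ¬tf)
                                      (trans (sym (owner-b ¬te)) (trans eq (owner-b ¬tf)))
      ... | inj₁ te | inj₂ ¬tf = ≁-resp (partner-a te) (partner-b ¬tf) $
        mixed e∈ f∈ e≢f ce cf te ¬tf (trans (sym (owner-a te)) (trans eq (owner-b ¬tf)))
      ... | inj₂ ¬te | inj₁ tf = ≁-resp (partner-b ¬te) (partner-a tf) $
        mixed f∈ e∈ (e≢f ∘ sym) cf ce tf ¬te (trans (sym (owner-a tf)) (trans (sym eq) (owner-b ¬te))) ∘ ∼-sym

      charge : Charge H X
      charge = record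
        { W              = Ca.W
        ; stable         = Ca.stable
        ; W⊆H            = All.map ⊆₁ Ca.W⊆S
        ; owner          = owner
        ; partner        = partner
        ; owner∈W        = owner∈W
        ; owner-adj      = λ e∈ c → across (All.lookup Ca.W⊆S (owner∈W e∈ c)) (partner∈ e∈ c)
        ; partners-apart = partners-apart
        }

  inside-free : ∀ {H X Ha Hb} → Split true H Ha Hb → Joined H X →
                Any.Any (λ e₀ → Counted H X e₀ × ¬ Touches Ha e₀) A →
                ∀ {e} → e ∈ A → Counted H X e → ¬ Within Ha e
  inside-free {H} {X} {Ha} {Hb} sp joined avoids {e} e∈ _ (a∈ , a′∈) with find avoids
  ... | e₀ , e₀∈ , (t₀ , within₀) , ¬ta₀ =
    conflict indA e∈ e₀∈ e≢e₀ forward (Joins-inEnd Hb e₀)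
             (inj₂ (across a∈ (x∈p∪q⁺ (inj₁ b∈)))) (inj₂ (across a∈ z∈))
             (inj₂ (across a′∈ (x∈p∪q⁺ (inj₁ b∈)))) (inj₂ (across a′∈ z∈))
    where
    across : ∀ {a y} → a ∈ₛ Ha → y ∈ₛ Hb ∪ X → Adj G a y
    across = Joined-across sp joined
    b∈ : inEnd Hb e₀ ∈ₛ Hb
    b∈ = inEnd∈ (Touches-other sp t₀ ¬ta₀)
    e≢e₀ : e ≢ e₀
    e≢e₀ refl = ¬ta₀ (touch₁ a∈)
    z∈ : outEnd Hb e₀ ∈ₛ Hb ∪ X
    z∈ with x∈p∪q⁻ Ha (Hb ∪ X) (Split-regroup sp (outEnd∈ within₀))
    ... | inj₁ z∈a = ⊥-elim (¬ta₀ (Joins-touches (Joins-swap (Joins-inEnd Hb e₀)) z∈a))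
    ... | inj₂ z∈  = z∈

  charge-join : ∀ {H X Ha Hb} → Split true H Ha Hb → Joined H X →
                Charge Ha (Hb ∪ X) → Charge Hb (Ha ∪ X) → CliqueCover Ha → CliqueCover Hb → Charge H X
  charge-join {H} {X} {Ha} {Hb} sp joined Ca Cb Va Vb
    with Any.any? (λ e → counted? H X e ×-dec ¬? (touches? Ha e)) A
       | Any.any? (λ e → counted? H X e ×-dec ¬? (touches? Hb e)) A
  ... | no none-avoid-Ha | _ =
    charge-transfer (Split.⊆₁ sp) (λ e∈ c → counted-join sp c (all-touch e∈ c)) Ca
    where
    all-touch : ∀ {e} → e ∈ A → Counted H X e → Touches Ha e
    all-touch {e} e∈ c = decidable-stable (touches? Ha e) λ ¬t → none-avoid-Ha (lose e∈ (c , ¬t))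
  ... | yes _ | no none-avoid-Hb =
    charge-transfer (Split.⊆₂ sp) (λ e∈ c → counted-join (Split-swap sp) c (all-touch e∈ c)) Cb
    where
    all-touch : ∀ {e} → e ∈ A → Counted H X e → Touches Hb e
    all-touch {e} e∈ c = decidable-stable (touches? Hb e) λ ¬t → none-avoid-Hb (lose e∈ (c , ¬t))
  ... | yes avoid-Ha | yes avoid-Hb
    with length (TwoSided.centres-bX sp joined Va Vb) ≤? length (TwoSided.centres-aX sp joined Va Vb)
  ...   | yes bX≤aX = TwoSided.charge sp joined Va Vb
                        (inside-free sp joined avoid-Ha) (inside-free (Split-swap sp) joined avoid-Hb) bX≤aX
  ...   | no  bX≰aX = TwoSided.charge (Split-swap sp) joined Vb Va
                        (inside-free (Split-swap sp) joined avoid-Hb) (inside-free sp joined avoid-Ha) (≰⇒≥ bX≰aX)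

  charge : ∀ {H X} → Cotree H → Joined H X → Charge H X
  charge (leaf v refl)           _      = charge-leaf v
  charge (node {false} sp t₁ t₂) joined =
    charge-union sp (charge t₁ (joined ∘ Split.⊆₁ sp)) (charge t₂ (joined ∘ Split.⊆₂ sp))
  charge (node {true} sp t₁ t₂)  joined =
    charge-join sp joined (charge t₁ (Joined-across sp joined)) (charge t₂ (Joined-across (Split-swap sp) joined))
                (cliqueCover t₁) (cliqueCover t₂)

module UpperBound {n : ℕ} (G : Graph n) (cograph : Cograph G)
                  (d : Fin n → ℕ) (d′ : ∀ x → IsDPrime G x (d x)) where
  open Basics G
  open Cotrees G
  open Construction cograph
  open Touching G

  nonempty-stable : Fin n → ∀ {k} W → Stable G W → k ≤ sum (map d W) →
                    ∃ λ W′ → IndepVertices G W′ × k ≤ sum (map d W′)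
  nonempty-stable v₀ []      _  k≤0 = v₀ ∷ [] , ([] ∷ [] , λ ()) , ≤-trans k≤0 z≤n
  nonempty-stable v₀ (w ∷ W) st k≤  = w ∷ W , (st , λ ()) , k≤

  upper-bound : Fin n → ∀ {A} → IndepEdges G A → ∃ λ W → IndepVertices G W × length A ≤ sum (map d W)
  upper-bound v₀ {A} indA =
    nonempty-stable v₀ W stable
      (≤-trans (length≤sum-fibres A W (λ e∈ → owner∈W e∈ (counted e∈))) (sum-map-mono _ d fibre≤d))
    where
    open Charging G indA
    open Charge (charge (cotree full (v₀ , ∈⊤)) λ _ x∈∅ → ⊥-elim (∉⊥ x∈∅))
    open Fibres _≟_ owner
    counted : ∀ {e} → e ∈ A → Counted full ∅ e
    counted _ = touch₁ ∈⊤ , x∈p∪q⁺ (inj₁ ∈⊤) , x∈p∪q⁺ (inj₁ ∈⊤)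
    fibre≤d : ∀ {w} → w ∈ W → length (fibre A w) ≤ d w
    fibre≤d {w} _ = subst (_≤ d w) (length-map partner (fibre A w))
                          (proj₂ (d′ w) (map partner (fibre A w)) in-nbhd partners-stable)
      where
      in-fibre : ∀ {e} → e ∈ fibre A w → e ∈ A × owner e ≡ w
      in-fibre = ∈-filter⁻ (λ e → owner e ≟ w) {xs = A}
      in-nbhd : InNbhd G w (map partner (fibre A w))
      in-nbhd = AllP.map⁺ (All.tabulate λ e∈ →
        let (e∈A , owner≡w) = in-fibre e∈ in subst (λ u → Adj G u _) owner≡w (owner-adj e∈A (counted e∈A)))
      partners-stable : Stable G (map partner (fibre A w))
      partners-stable =
        AllPairs.map⁺ (AllPairs-from-∈ (AllPairs.filter⁺ _ (IndepEdges⇒Unique indA)) λ e∈ f∈ e≢f →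
          let (e∈A , owner-e) = in-fibre e∈ ; (f∈A , owner-f) = in-fibre f∈
              apart = partners-apart e∈A f∈A e≢f (counted e∈A) (counted f∈A) (trans owner-e (sym owner-f))
          in apart ∘ inj₁ , apart ∘ inj₂)

lemma3 : ∀ {n : ℕ} (G : Graph (suc n)) → Cograph G →
         (d : Fin (suc n) → ℕ) → (∀ x → IsDPrime G x (d x)) →
         ∀ k → IsAlphaPrime G k ⇔ IsMaxWeightIndep G d k
lemma3 G cograph d d′ k = mk⇔ to from
  where
  open LowerBound G d d′
  open UpperBound G cograph d d′

  to : IsAlphaPrime G k → IsMaxWeightIndep G d k
  to ((A , indA , |A|≡k) , α′-max) with upper-bound zero indA
  ... | W , indW , |A|≤ =
    (W , indW , ≤-antisym (weight≤k indW) (subst (_≤ _) |A|≡k |A|≤)) , λ _ → weight≤k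
    where
    weight≤k : ∀ {W} → IndepVertices G W → sum (map d W) ≤ k
    weight≤k {W} (stW , _) = subst (_≤ k) (length-fans W) (α′-max (fans W) (fans-independent stW))

  from : IsMaxWeightIndep G d k → IsAlphaPrime G k
  from ((W , (stW , _) , weight≡k) , weight-max) =
    (fans W , fans-independent stW , trans (length-fans W) weight≡k) , λ A indA →
      let (W′ , indW′ , |A|≤) = upper-bound zero indA in ≤-trans |A|≤ (weight-max W′ indW′)
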